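{- Let $n\ge 3$ be odd and let $X\subseteq\mathbb Z_{2n}$ satisfy $-X=X$. Then $\mathcal P(X)\subseteq D_{2n}$ is strongly symmetric. Moreover, if $0\notin X$, then $e\notin\mathcal P(X)$.
   Context: $D_{2n}=\langle r,s\mid r^n=e,\ s^2=e,\ srs=r^{ -1}\rangle$, $R=\{r^j\}$ (rotations), $M=\{sr^j\}$ (reflections). Let $\varphi\colon\mathbb Z_{2n}\to\mathbb Z_2\times\mathbb Z_n$, $x\mapsto(x\bmod 2,\ x\bmod n)$ (a group isomorphism since $n$ is odd), and let $\psi\colon\mathbb Z_2\times\mathbb Z_n\to D_{2n}$ be the set bijection $(i,j)\mapsto s^ir^j$. For $X\subseteq\mathbb Z_{2n}$, $\mathcal P(X):=\psi(\varphi(X))$. A subset $\widetilde X\subseteq D_{2n}$ is strongly symmetric if for all $j$: $r^j\in\widetilde X\iff r^{ -j}\in\widetilde X$, and $sr^j\in\widetilde X\iff sr^{ -j}\in\widetilde X$. -}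

module Defs where

open import Data.Nat using (ℕ; zero; suc; _*_; _∸_)
open import Data.Nat.DivMod using (_mod_)
open import Data.Fin using (Fin; zero; suc; toℕ)
open import Data.Product using (Σ; _×_; _,_)
open import Relation.Binary.PropositionalEquality using (_≡_)
open import Function.Bundles using (_⇔_)
open import Level using (0ℓ)
open import Relation.Unary using (Pred)

-- ℤ_m is represented by Fin m; negation x ↦ -x mod m
negF : ∀ {m} → Fin m → Fin m
negF {suc m} x = (suc m ∸ toℕ x) mod (suc m)

Subset : Set → Set₁
Subset A = Pred A 0ℓ

SymmetricSubset : ∀ {m} → Subset (Fin m) → Set
SymmetricSubset X = ∀ x → X x ⇔ X (negF x)

φ : ∀ {n} → Fin (2 * n) → Fin 2 × Fin n
φ {suc n} x = (toℕ x mod 2 , toℕ x mod suc n)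

-- Elements of D_{2n} in normal form s^i r^j  (i ∈ {0,1}, j ∈ ℤ_n)
data D (n : ℕ) : Set where
  rot : Fin n → D n
  ref : Fin n → D n

e : ∀ {n} → D (suc n)
e = rot zero

ψ : ∀ {n} → Fin 2 × Fin n → D n
ψ (zero , j) = rot j
ψ (suc _ , j) = ref j

𝒫 : ∀ {n} → Subset (Fin (2 * n)) → Subset (D n)
𝒫 X d = Σ _ λ x → X x × ψ (φ x) ≡ d

StronglySymmetric : ∀ {n} → Subset (D n) → Set
StronglySymmetric S =
  ∀ j → (S (rot j) ⇔ S (rot (negF j))) × (S (ref j) ⇔ S (ref (negF j)))

{-# OPTIONS --safe #-}
-- Negation x ↦ -x on ℤ_{2n} is carried by φ to (i , j) ↦ (i , -j), since reduction modulo a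
-- divisor commutes with negation and -i = i in ℤ_2; ψ then turns this into s^i r^j ↦ s^i r^-j.
-- Hence 𝒫(X) is closed under that involution, which is strong symmetry.  For the second claim,
-- φ x = (0 , 0) makes x a multiple of the odd number n below 2n that is even, so x = 0.
module Submission where

open import Defs
open import Data.Nat using (ℕ; zero; suc; _+_; _*_; _∸_; _≤_; _<_; _%_; _/_; NonZero; s≤s)
open import Data.Nat.Properties
open import Data.Nat.DivMod
open import Data.Nat.Divisibility using (_∣_; divides-refl; ∣-refl; n∣m*n; m∣m*n; n∣m⇒m%n≡0; m%n≡0⇒n∣m)
open import Data.Fin using (Fin; toℕ; zero; suc)
open import Data.Fin.Properties using (toℕ-injective; toℕ-fromℕ<; toℕ<n)
open import Data.Product using (_×_; _,_; proj₁; proj₂; map₂)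
open import Function.Base using (_∘_)
open import Function.Bundles using (_⇔_; mk⇔; Equivalence)
open import Relation.Binary.PropositionalEquality
open import Relation.Nullary using (¬_)

[m∸n]%d≡[d∸n%d]%d : ∀ {m d} .{{_ : NonZero d}} → d ∣ m →
                    ∀ {n} → n ≤ m → (m ∸ n) % d ≡ (d ∸ n % d) % d
[m∸n]%d≡[d∸n%d]%d {m} {d} d∣m {n} n≤m = begin
  (m ∸ n) % d           ≡⟨ cong (λ k → (m ∸ k) % d) (m≡m%n+[m/n]*n n d) ⟩
  (m ∸ (r + q * d)) % d ≡⟨ cong (_% d) (∸-+-assoc m r (q * d)) ⟨
  (m ∸ r ∸ q * d) % d   ≡⟨ m*n≤o⇒[o∸m*n]%n≡o%n q q*d≤m∸r ⟩
  (m ∸ r) % d           ≡⟨ [m+n]%n≡m%n (m ∸ r) d ⟨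
  (m ∸ r + d) % d       ≡⟨ cong (_% d) (trans (sym (+-∸-assoc m r≤d)) (+-∸-comm d r≤m)) ⟨
  (m + (d ∸ r)) % d     ≡⟨ %-remove-+ˡ (d ∸ r) d∣m ⟩
  (d ∸ r) % d           ∎
  where
  open ≡-Reasoning
  r = n % d
  q = n / d
  r≤m : r ≤ m
  r≤m = ≤-trans (m%n≤m n d) n≤m
  r≤d : r ≤ d
  r≤d = m%n≤n n d
  q*d≤m∸r : q * d ≤ m ∸ r
  q*d≤m∸r = m+n≤o⇒m≤o∸n (q * d)
    (subst (_≤ m) (trans (m≡m%n+[m/n]*n n d) (+-comm r (q * d))) n≤m)

toℕ-negF : ∀ {m} (x : Fin (suc m)) → toℕ (negF x) ≡ (suc m ∸ toℕ x) % suc m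
toℕ-negF _ = toℕ-fromℕ< _

negF-involutive : ∀ {m} (x : Fin (suc m)) → negF (negF x) ≡ x
negF-involutive {m} x = toℕ-injective (begin
  toℕ (negF (negF x))         ≡⟨ toℕ-negF (negF x) ⟩
  (M ∸ toℕ (negF x)) % M      ≡⟨ cong (λ k → (M ∸ k) % M) (toℕ-negF x) ⟩
  (M ∸ (M ∸ t) % M) % M       ≡⟨ [m∸n]%d≡[d∸n%d]%d ∣-refl (m∸n≤m M t) ⟨
  (M ∸ (M ∸ t)) % M           ≡⟨ cong (_% M) (m∸[m∸n]≡n (<⇒≤ (toℕ<n x))) ⟩
  t % M                       ≡⟨ m<n⇒m%n≡m (toℕ<n x) ⟩
  t                           ∎)
  where
  open ≡-Reasoning
  M = suc m
  t = toℕ x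

mod-negF : ∀ {m n} → suc n ∣ suc m → (x : Fin (suc m)) →
           toℕ (negF x) mod suc n ≡ negF (toℕ x mod suc n)
mod-negF {m} {n} N∣M x = toℕ-injective (begin
  toℕ (toℕ (negF x) mod N)    ≡⟨ toℕ-fromℕ< _ ⟩
  toℕ (negF x) % N            ≡⟨ cong (_% N) (toℕ-negF x) ⟩
  (M ∸ t) % M % N             ≡⟨ m∣n⇒o%n%m≡o%m N M (M ∸ t) N∣M ⟩
  (M ∸ t) % N                 ≡⟨ [m∸n]%d≡[d∸n%d]%d N∣M (<⇒≤ (toℕ<n x)) ⟩
  (N ∸ t % N) % N             ≡⟨ cong (λ k → (N ∸ k) % N) (toℕ-fromℕ< (m%n<n t N)) ⟨
  (N ∸ toℕ (t mod N)) % N     ≡⟨ toℕ-negF (t mod N) ⟨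
  toℕ (negF (t mod N))        ∎)
  where
  open ≡-Reasoning
  M = suc m
  N = suc n
  t = toℕ x

negF-Fin2 : (i : Fin 2) → negF i ≡ i
negF-Fin2 zero       = refl
negF-Fin2 (suc zero) = refl

φ-negF : ∀ {n} (x : Fin (2 * suc n)) → φ (negF x) ≡ map₂ negF (φ x)
φ-negF {n} x = cong₂ _,_
  (trans (mod-negF (m∣m*n (suc n)) x) (negF-Fin2 (toℕ x mod 2)))
  (mod-negF (n∣m*n 2) x)

negD : ∀ {n} → D n → D n
negD (rot j) = rot (negF j)
negD (ref j) = ref (negF j)

negD-involutive : ∀ {n} (d : D (suc n)) → negD (negD d) ≡ d
negD-involutive (rot j) = cong rot (negF-involutive j)
negD-involutive (ref j) = cong ref (negF-involutive j)

ψ-map₂-negF : ∀ {n} (p : Fin 2 × Fin n) → ψ (map₂ negF p) ≡ negD (ψ p)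
ψ-map₂-negF (zero  , j) = refl
ψ-map₂-negF (suc _ , j) = refl

𝒫-negD : ∀ {n} {X : Subset (Fin (2 * suc n))} → SymmetricSubset X →
         ∀ {d} → 𝒫 X d → 𝒫 X (negD d)
𝒫-negD symX {d} (x , x∈X , ψφx≡d) =
  negF x , Equivalence.to (symX x) x∈X , (begin
    ψ (φ (negF x))      ≡⟨ cong ψ (φ-negF x) ⟩
    ψ (map₂ negF (φ x)) ≡⟨ ψ-map₂-negF (φ x) ⟩
    negD (ψ (φ x))      ≡⟨ cong negD ψφx≡d ⟩
    negD d              ∎)
  where open ≡-Reasoning

closed-under-involution⇒⇔ : ∀ {A : Set} {P : Subset A} (f : A → A) → (∀ a → f (f a) ≡ a) →
                            (∀ {a} → P a → P (f a)) → ∀ a → P a ⇔ P (f a)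
closed-under-involution⇒⇔ {P = P} f f-involutive closed a =
  mk⇔ closed (λ Pfa → subst P (f-involutive a) (closed Pfa))

n%2≡1⇒2∣m⇒n∣m⇒m<2*n⇒m≡0 : ∀ {m n} → n % 2 ≡ 1 → 2 ∣ m → n ∣ m → m < 2 * n → m ≡ 0
n%2≡1⇒2∣m⇒n∣m⇒m<2*n⇒m≡0 _ _ (divides-refl 0) _ = refl
n%2≡1⇒2∣m⇒n∣m⇒m<2*n⇒m≡0 {n = n} n%2≡1 2∣1*n (divides-refl 1) _
  with trans (sym n%2≡1) (trans (cong (_% 2) (sym (*-identityˡ n))) (n∣m⇒m%n≡0 _ 2 2∣1*n))
... | ()
n%2≡1⇒2∣m⇒n∣m⇒m<2*n⇒m≡0 {n = n} _ _ (divides-refl (suc (suc q))) q*n<2*n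
  with *-cancelʳ-< n (2 + q) 2 q*n<2*n
... | s≤s (s≤s ())

φ≡0⇒toℕ≡0 : ∀ {n} → suc n % 2 ≡ 1 → (x : Fin (2 * suc n)) → φ x ≡ (zero , zero) → toℕ x ≡ 0
φ≡0⇒toℕ≡0 {n} odd x φx≡0 = n%2≡1⇒2∣m⇒n∣m⇒m<2*n⇒m≡0 odd
  (∣t 2 (cong (toℕ ∘ proj₁) φx≡0)) (∣t (suc n) (cong (toℕ ∘ proj₂) φx≡0)) (toℕ<n x)
  where
  t = toℕ x
  ∣t : ∀ k .{{_ : NonZero k}} → toℕ (t mod k) ≡ 0 → k ∣ t
  ∣t k t-mod-k≡0 = m%n≡0⇒n∣m t k (trans (sym (toℕ-fromℕ< (m%n<n t k))) t-mod-k≡0)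

ψ≡rot⇒≡ : ∀ {n} (p : Fin 2 × Fin n) {j} → ψ p ≡ rot j → p ≡ (zero , j)
ψ≡rot⇒≡ (zero , _) refl = refl

mainTheorem16 : (n : ℕ) → 3 ≤ n → n % 2 ≡ 1 →
    (X : Subset (Fin (2 * n))) → SymmetricSubset X →
    StronglySymmetric (𝒫 {n} X)
      × ((∀ (z : Fin (2 * n)) → toℕ z ≡ 0 → ¬ X z) →
         ∀ (j : Fin n) → toℕ j ≡ 0 → ¬ 𝒫 {n} X (rot j))
mainTheorem16 (suc n) _ odd X symX = stronglySymmetric , e∉𝒫X
  where
  stronglySymmetric : StronglySymmetric (𝒫 X)
  stronglySymmetric j = 𝒫X⇔𝒫X∘negD (rot j) , 𝒫X⇔𝒫X∘negD (ref j)
    where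
    𝒫X⇔𝒫X∘negD : ∀ d → 𝒫 X d ⇔ 𝒫 X (negD d)
    𝒫X⇔𝒫X∘negD = closed-under-involution⇒⇔ negD negD-involutive (𝒫-negD symX)
  e∉𝒫X : (∀ z → toℕ z ≡ 0 → ¬ X z) → ∀ j → toℕ j ≡ 0 → ¬ 𝒫 X (rot j)
  e∉𝒫X 0∉X j j≡0 (x , x∈X , ψφx≡rot-j) = 0∉X x (φ≡0⇒toℕ≡0 odd x φx≡0) x∈X
    where
    φx≡0 : φ x ≡ (zero , zero)
    φx≡0 = trans (ψ≡rot⇒≡ (φ x) ψφx≡rot-j) (cong (zero ,_) (toℕ-injective j≡0))
mainTheorem16 zero () _ _ _
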